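{- Let $n$ be a positive integer and $R_n=\{(i-1)n^2+i^2 : i\in\{1,\dots,n\}\}$. Then: (1) the least element of $R_n$ is $1$ and the greatest is $n^3$; (2) $|R_n|=n$; (3) the distance between any two distinct elements of $R_n$ is at least $n^2+3$; (4) $R_n$ is a Golomb ruler.
   Context: A Golomb ruler is a finite set $R\subseteq\mathbb{Z}$ such that for every $t\in\mathbb{Z}$ with $t\neq0$, $|R\cap(R+t)|\le1$ (equivalently, every positive integer is the difference $r-s$ of at most one pair $(r,s)\in R\times R$). -}

module Defs where

open import Data.Nat using (ℕ; suc)
open import Data.Integer using (ℤ; +_; _+_; _-_; _*_; _≤_; ∣_∣)
open import Data.Integer.Properties using (_≟_)
open import Data.List using (List; map; upTo; length; deduplicate)
open import Data.List.Membership.Propositional using (_∈_)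
open import Relation.Binary.PropositionalEquality using (_≡_; _≢_)

-- Finite subsets of ℤ are represented by lists; the set is the set of members.

card : List ℤ → ℕ
card R = length (deduplicate _≟_ R)

-- x ∈ R + t  iff  x - t ∈ R ; "|R ∩ (R+t)| ≤ 1" means any two elements of
-- R ∩ (R+t) coincide.
GolombRuler : List ℤ → Set
GolombRuler R = ∀ (t : ℤ) → t ≢ + 0 →
  ∀ (x y : ℤ) → x ∈ R → (x - t) ∈ R → y ∈ R → (y - t) ∈ R → x ≡ y

oneTo : ℕ → List ℕ
oneTo n = map suc (upTo n)

rElem : ℕ → ℕ → ℤ
rElem n i = (+ i - + 1) * (+ n * + n) + + i * + i

R : ℕ → List ℤ
R n = map (rElem n) (oneTo n)

IsLeast : ℤ → List ℤ → Set
IsLeast m S = m ∈ S × (∀ x → x ∈ S → m ≤ x)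
  where open import Data.Product using (_×_)

IsGreatest : ℤ → List ℤ → Set
IsGreatest m S = m ∈ S × (∀ x → x ∈ S → x ≤ m)
  where open import Data.Product using (_×_)

module Submission where

-- Write N = n² and h j = j·N + (j+1)² for j < n; then rElem n (j+1) = h j, so
-- R_n = {h 0, …, h (n-1)}.  Everything follows from two computations with h.
--
-- * Consecutive gaps: h (j+1) = h j + N + (2j+3).  Hence h increases by at least
--   N+3 at every step, so its extreme values are h 0 = 1 and h (n-1) = n³, it is
--   injective (so |R_n| = n) and distinct marks are at least N+3 apart.
--
-- * Differences: h (q+K) = h q + (K·N + K(2q+K+2)), and when q+K < n the
--   "excess" K(2q+K+2) = (q+K+1)² - (q+1)² is smaller than N.  By uniqueness of
--   quotient and remainder modulo N, the difference h (q+K) - h q determines K,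
--   and then q.  So h is a Sidon sequence on {0,…,n-1}: h p + h s = h r + h q
--   forces p = r or p = q.
--
-- The Golomb property is the Sidon property applied to x + (y - t) = y + (x - t).

open import Defs
open import Data.Nat using (ℕ; _^_; _+_) renaming (_≤_ to _≤ℕ_)
open import Data.Integer using (ℤ; +_; _-_; ∣_∣; _⊖_)
open import Data.Product using (_×_)
open import Data.List.Membership.Propositional using (_∈_)
open import Relation.Binary.PropositionalEquality using (_≡_; _≢_)

open import Data.Nat using (suc; zero; _*_; _∸_; _<_; z≤n; s≤s)
import Data.Nat.Properties as ℕₚ
import Data.Integer as ℤ
import Data.Integer.Properties as ℤₚ
open import Data.Product using (Σ-syntax; _,_; proj₁; proj₂)
open import Data.Sum using (_⊎_; inj₁; inj₂)
open import Data.List using ([]; _∷_; map; upTo; length; deduplicate)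
open import Data.List.Properties using (filter-all; length-map; length-upTo; map-∘)
open import Data.List.Relation.Unary.AllPairs using (_∷_)
open import Data.List.Relation.Unary.Unique.Propositional using (Unique)
import Data.List.Relation.Unary.Unique.Propositional.Properties as Uniqueₚ
open import Data.List.Membership.Propositional.Properties
  using (∈-map⁺; ∈-map⁻; ∈-upTo⁺; ∈-upTo⁻)
open import Relation.Binary using (tri<; tri≈; tri>)
open import Relation.Binary.Definitions using (DecidableEquality)
open import Relation.Binary.PropositionalEquality
  using (refl; sym; trans; cong; cong₂; subst; subst₂; module ≡-Reasoning)
open import Relation.Nullary using (¬?)
open import Data.Empty using (⊥-elim)
open import Data.Nat.Tactic.RingSolver using (solve-∀)
import Data.Integer.Tactic.RingSolver as ℤ-Solver

deduplicate-unique : ∀ {a} {A : Set a} (_≟_ : DecidableEquality A) xs →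
                     Unique xs → deduplicate _≟_ xs ≡ xs
deduplicate-unique _≟_ []       _          = refl
deduplicate-unique _≟_ (x ∷ xs) (x∉ ∷ !xs) rewrite deduplicate-unique _≟_ xs !xs =
  cong (x ∷_) (filter-all (λ y → ¬? (x ≟ y)) x∉)

quotient-remainder-unique : ∀ N k l {u v} → k * N + u ≡ l * N + v →
                            u < N → v < N → k ≡ l × u ≡ v
quotient-remainder-unique N zero    zero    e u<N v<N = refl , e
quotient-remainder-unique N zero    (suc l) {u} {v} e u<N v<N =
  ⊥-elim (ℕₚ.<⇒≱ u<N (subst (N ≤ℕ_) (trans (sym (ℕₚ.+-assoc N (l * N) v)) (sym e))
                                      (ℕₚ.m≤m+n N (l * N + v))))
quotient-remainder-unique N (suc k) zero    {u} {v} e u<N v<N =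
  ⊥-elim (ℕₚ.<⇒≱ v<N (subst (N ≤ℕ_) (trans (sym (ℕₚ.+-assoc N (k * N) u)) e)
                                      (ℕₚ.m≤m+n N (k * N + u))))
quotient-remainder-unique N (suc k) (suc l) {u} {v} e u<N v<N
  with k≡l , u≡v ← quotient-remainder-unique N k l
         (ℕₚ.+-cancelˡ-≡ N _ _ (trans (sym (ℕₚ.+-assoc N (k * N) u))
                                      (trans e (ℕₚ.+-assoc N (l * N) v))))
         u<N v<N
  = cong suc k≡l , u≡v

shift-zero : ∀ x t → x - t ≡ x → t ≡ + 0
shift-zero x t x-t≡x = begin
  t             ≡⟨ double-shift x t ⟩
  x - (x - t)   ≡⟨ cong (x -_) x-t≡x ⟩
  x - x         ≡⟨ ℤₚ.+-inverseʳ x ⟩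
  + 0           ∎
  where
  open ≡-Reasoning
  double-shift : ∀ x t → t ≡ x - (x - t)
  double-shift = ℤ-Solver.solve-∀

module Marks (n : ℕ) where

  N : ℕ
  N = n * n

  -- the mark with index j, i.e. the (j+1)-st element of R_n
  h : ℕ → ℕ
  h j = j * N + suc j * suc j

  rElem≡h : ∀ j → rElem n (suc j) ≡ + h j
  rElem≡h j = begin
    (+ suc j - + 1) ℤ.* (+ n ℤ.* + n) ℤ.+ + suc j ℤ.* + suc j
      ≡⟨ cong (λ i → i ℤ.* (+ n ℤ.* + n) ℤ.+ + suc j ℤ.* + suc j) (ℤₚ.m-n≡m⊖n (suc j) 1) ⟩
    + j ℤ.* (+ n ℤ.* + n) ℤ.+ + suc j ℤ.* + suc j
      ≡⟨ cong (λ i → + j ℤ.* i ℤ.+ + suc j ℤ.* + suc j) (sym (ℤₚ.pos-* n n)) ⟩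
    + j ℤ.* + (n * n) ℤ.+ + suc j ℤ.* + suc j
      ≡⟨ cong₂ ℤ._+_ (sym (ℤₚ.pos-* j (n * n))) (sym (ℤₚ.pos-* (suc j) (suc j))) ⟩
    + (j * (n * n)) ℤ.+ + (suc j * suc j)
      ≡⟨ sym (ℤₚ.pos-+ (j * (n * n)) (suc j * suc j)) ⟩
    + h j ∎
    where open ≡-Reasoning

  ∈R⁻ : ∀ {x} → x ∈ R n → Σ[ j ∈ ℕ ] j < n × x ≡ + h j
  ∈R⁻ x∈ with ∈-map⁻ (rElem n) x∈
  ... | _ , i∈ , refl with ∈-map⁻ suc i∈
  ... | j , j∈ , refl = j , ∈-upTo⁻ j∈ , rElem≡h j

  ∈R⁺ : ∀ {j} → j < n → + h j ∈ R n
  ∈R⁺ {j} j<n = subst (_∈ R n) (rElem≡h j) (∈-map⁺ (rElem n) (∈-map⁺ suc (∈-upTo⁺ j<n)))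

  h-step : ∀ j → N + 3 + h j ≤ℕ h (suc j)
  h-step j = subst (N + 3 + h j ≤ℕ_) (sym (next j n))
                   (ℕₚ.+-monoʳ-≤ (N + 3) (ℕₚ.m≤m+n (h j) (2 * j)))
    where
    next : ∀ j n → suc j * (n * n) + suc (suc j) * suc (suc j)
                 ≡ n * n + 3 + (j * (n * n) + suc j * suc j + 2 * j)
    next = solve-∀

  h-gap : ∀ {a b} → a < b → N + 3 + h a ≤ℕ h b
  h-gap {a} {suc b} (s≤s a≤b) with ℕₚ.m≤n⇒m<n∨m≡n a≤b
  ... | inj₂ refl = h-step a
  ... | inj₁ a<b  = ℕₚ.≤-trans (h-gap a<b) (ℕₚ.≤-trans (ℕₚ.m≤n+m (h b) (N + 3)) (h-step b))

  h-strict : ∀ {a b} → a < b → h a < h b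
  h-strict {a} a<b =
    ℕₚ.<-≤-trans (ℕₚ.m<n+m (h a) {N + 3} (ℕₚ.≤-trans (s≤s z≤n) (ℕₚ.m≤n+m 3 N))) (h-gap a<b)

  h-mono : ∀ {a b} → a ≤ℕ b → h a ≤ℕ h b
  h-mono a≤b with ℕₚ.m≤n⇒m<n∨m≡n a≤b
  ... | inj₁ a<b  = ℕₚ.<⇒≤ (h-strict a<b)
  ... | inj₂ refl = ℕₚ.≤-refl

  h-injective : ∀ {a b} → h a ≡ h b → a ≡ b
  h-injective {a} {b} e with ℕₚ.<-cmp a b
  ... | tri< a<b _ _ = ⊥-elim (ℕₚ.<⇒≢ (h-strict a<b) e)
  ... | tri≈ _ a≡b _ = a≡b
  ... | tri> _ _ b<a = ⊥-elim (ℕₚ.<⇒≢ (h-strict b<a) (sym e))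

  -- the part of h (q + K) - h q beyond the multiple K·N, written with K = 1+k
  excess : ℕ → ℕ → ℕ
  excess q k = suc k * (2 * q + suc k + 2)

  h-difference : ∀ q k → h (suc q + k) ≡ h q + (suc k * N + excess q k)
  h-difference q k = expand q k n
    where
    expand : ∀ q k n → (suc q + k) * (n * n) + suc (suc q + k) * suc (suc q + k)
                     ≡ q * (n * n) + suc q * suc q + (suc k * (n * n) + suc k * (2 * q + suc k + 2))
    expand = solve-∀

  -- excess q k + (q+1)² = (q+k+2)² ≤ n², and (q+1)² is positive.
  excess<N : ∀ q k → suc q + k < n → excess q k < N
  excess<N q k lt = ℕₚ.<-≤-trans (ℕₚ.m<m+n (excess q k) (s≤s z≤n))
    (subst (_≤ℕ N) (sym (complete-square q k)) (ℕₚ.*-mono-≤ lt lt))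
    where
    complete-square : ∀ q k → suc k * (2 * q + suc k + 2) + suc q * suc q
                                ≡ suc (suc q + k) * suc (suc q + k)
    complete-square = solve-∀

  excess-injective : ∀ {q s} k → excess q k ≡ excess s k → q ≡ s
  excess-injective {q} {s} k e =
    ℕₚ.*-cancelˡ-≡ q s 2 (ℕₚ.+-cancelʳ-≡ (suc k) _ _
      (ℕₚ.+-cancelʳ-≡ 2 _ _ (ℕₚ.*-cancelˡ-≡ _ _ (suc k) e)))

  -- The difference of two marks determines both of them: equal differences give
  -- equal quotients and remainders modulo N, i.e. equal K and then equal q.
  differences-distinct : ∀ q k s l → suc q + k < n → suc s + l < n →
    h (suc q + k) + h s ≡ h (suc s + l) + h q → q ≡ s × k ≡ l
  differences-distinct q k s l q+k<n s+l<n e = q≡s , k≡l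
    where
    cancel-sides : ∀ a b d d′ → a + d + b ≡ b + d′ + a → d ≡ d′
    cancel-sides a b d d′ eq = ℕₚ.+-cancelˡ-≡ (a + b) d d′ (begin
      a + b + d  ≡⟨ left a b d ⟩
      a + d + b  ≡⟨ eq ⟩
      b + d′ + a ≡⟨ right a b d′ ⟩
      a + b + d′ ∎)
      where
      open ≡-Reasoning
      left : ∀ a b d → a + b + d ≡ a + d + b
      left = solve-∀
      right : ∀ a b d → b + d + a ≡ a + b + d
      right = solve-∀
    same-difference : suc k * N + excess q k ≡ suc l * N + excess s l
    same-difference = cancel-sides (h q) (h s) _ _
      (subst₂ (λ a b → a + h s ≡ b + h q) (h-difference q k) (h-difference s l) e)
    quotients-and-remainders : suc k ≡ suc l × excess q k ≡ excess s l
    quotients-and-remainders = quotient-remainder-unique N (suc k) (suc l) same-difference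
      (excess<N q k q+k<n) (excess<N s l s+l<n)
    k≡l : k ≡ l
    k≡l = ℕₚ.suc-injective (proj₁ quotients-and-remainders)
    q≡s : q ≡ s
    q≡s = excess-injective k (trans (proj₂ quotients-and-remainders) (cong (excess s) (sym k≡l)))

  marks-ordered : ∀ {p q r s} → q < p → h p + h s ≡ h r + h q → s < r
  marks-ordered {p} {s = s} q<p e = ℕₚ.≰⇒> λ r≤s →
    ℕₚ.<⇒≢ (ℕₚ.+-mono-≤-< (h-mono r≤s) (h-strict q<p))
           (trans (sym e) (ℕₚ.+-comm (h p) (h s)))

  sidon-ordered : ∀ {p q r s} → q < p → p < n → r < n →
                  h p + h s ≡ h r + h q → p ≡ r × q ≡ s
  sidon-ordered {p} {q} {r} {s} q<p p<n r<n e
    with k , refl ← ℕₚ.m≤n⇒∃[o]m+o≡n {suc q} {p} q<p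
       | l , refl ← ℕₚ.m≤n⇒∃[o]m+o≡n {suc s} {r} (marks-ordered q<p e)
    with refl , refl ← differences-distinct q k s l p<n r<n e
    = refl , refl

  sidon : ∀ {p q r s} → p < n → q < n → r < n → s < n →
          h p + h s ≡ h r + h q → p ≡ r ⊎ p ≡ q
  sidon {p} {q} {r} {s} p<n q<n r<n s<n e with ℕₚ.<-cmp p q
  ... | tri< p<q _ _ = inj₁ (proj₂ (sidon-ordered p<q q<n s<n
                          (trans (ℕₚ.+-comm (h q) (h r)) (trans (sym e) (ℕₚ.+-comm (h p) (h s))))))
  ... | tri≈ _ p≡q _ = inj₂ p≡q
  ... | tri> _ _ q<p = inj₁ (proj₁ (sidon-ordered {s = s} q<p p<n r<n e))

  -- The statement measures distances in n ^ 2 rather than n * n.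
  n²≡N : n ^ 2 ≡ N
  n²≡N = cong (n *_) (ℕₚ.*-identityʳ n)

  mark-distance : ∀ {a b} → a < b → N + 3 ≤ℕ ∣ + h a - + h b ∣
  mark-distance {a} {b} a<b = begin
    N + 3             ≤⟨ ℕₚ.m+n≤o⇒m≤o∸n (N + 3) (h-gap a<b) ⟩
    h b ∸ h a         ≡⟨ sym (ℤₚ.∣⊖∣-< (h-strict a<b)) ⟩
    ∣ h a ⊖ h b ∣     ≡⟨ cong ∣_∣ (sym (ℤₚ.m-n≡m⊖n (h a) (h b))) ⟩
    ∣ + h a - + h b ∣ ∎
    where open ℕₚ.≤-Reasoning

  R-least : 0 < n → IsLeast (+ 1) (R n)
  R-least 0<n = ∈R⁺ 0<n , lower-bound
    where
    lower-bound : ∀ x → x ∈ R n → + 1 ℤ.≤ x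
    lower-bound x x∈ with ∈R⁻ x∈
    ... | j , _ , refl = ℤ.+≤+ (h-mono {0} {j} z≤n)

  R-unique : Unique (R n)
  R-unique = subst Unique (map-∘ (upTo n)) (Uniqueₚ.map⁺ rElem-suc-injective (Uniqueₚ.upTo⁺ n))
    where
    rElem-suc-injective : ∀ {a b} → rElem n (suc a) ≡ rElem n (suc b) → a ≡ b
    rElem-suc-injective {a} {b} e =
      h-injective (ℤₚ.+-injective (trans (sym (rElem≡h a)) (trans e (rElem≡h b))))

  R-card : card (R n) ≡ n
  R-card = begin
    length (deduplicate ℤₚ._≟_ (R n)) ≡⟨ cong length (deduplicate-unique ℤₚ._≟_ (R n) R-unique) ⟩
    length (R n)                      ≡⟨ length-map (rElem n) (map suc (upTo n)) ⟩
    length (map suc (upTo n))         ≡⟨ length-map suc (upTo n) ⟩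
    length (upTo n)                   ≡⟨ length-upTo n ⟩
    n                                 ∎
    where open ≡-Reasoning

  R-separated : ∀ x y → x ∈ R n → y ∈ R n → x ≢ y → n ^ 2 + 3 ≤ℕ ∣ x - y ∣
  R-separated x y x∈ y∈ x≢y rewrite n²≡N with ∈R⁻ x∈ | ∈R⁻ y∈
  ... | a , _ , refl | b , _ , refl with ℕₚ.<-cmp a b
  ... | tri< a<b _ _ = mark-distance a<b
  ... | tri≈ _ refl _ = ⊥-elim (x≢y refl)
  ... | tri> _ _ b<a = subst (N + 3 ≤ℕ_) (ℤₚ.∣i-j∣≡∣j-i∣ (+ h b) (+ h a)) (mark-distance b<a)

  -- Claim (4): if x, x - t, y, y - t are marks then x + (y - t) = y + (x - t), so
  -- by the Sidon property either x = y, or x - t = x and t = 0.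
  R-golomb : GolombRuler (R n)
  R-golomb t t≢0 x y x∈ x-t∈ y∈ y-t∈
    with ∈R⁻ x∈ | ∈R⁻ x-t∈ | ∈R⁻ y∈ | ∈R⁻ y-t∈
  ... | p , p<n , refl | q , q<n , x-t≡ | r , r<n , refl | s , s<n , y-t≡
    with sidon p<n q<n r<n s<n (ℤₚ.+-injective sums-equal)
    where
    sums-equal : + (h p + h s) ≡ + (h r + h q)
    sums-equal = begin
      + (h p + h s)               ≡⟨ ℤₚ.pos-+ (h p) (h s) ⟩
      + h p ℤ.+ + h s             ≡⟨ cong (ℤ._+_ (+ h p)) (sym y-t≡) ⟩
      + h p ℤ.+ (+ h r - t)       ≡⟨ exchange (+ h p) (+ h r) t ⟩
      + h r ℤ.+ (+ h p - t)       ≡⟨ cong (ℤ._+_ (+ h r)) x-t≡ ⟩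
      + h r ℤ.+ + h q             ≡⟨ sym (ℤₚ.pos-+ (h r) (h q)) ⟩
      + (h r + h q)               ∎
      where
      open ≡-Reasoning
      exchange : ∀ x y t → x ℤ.+ (y - t) ≡ y ℤ.+ (x - t)
      exchange = ℤ-Solver.solve-∀
  ... | inj₁ refl = refl
  ... | inj₂ refl = ⊥-elim (t≢0 (shift-zero (+ h p) t x-t≡))

-- Claim (1), upper end: the last mark of R_{m+1} is h m = m·(m+1)² + (m+1)² = (m+1)³.
R-greatest : ∀ m → IsGreatest (+ (suc m ^ 3)) (R (suc m))
R-greatest m = subst (λ z → + z ∈ R (suc m)) last-mark (∈R⁺ ℕₚ.≤-refl) , upper-bound
  where
  open Marks (suc m)
  cube : ∀ m → m * (suc m * suc m) + suc m * suc m ≡ suc m * (suc m * (suc m * 1))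
  cube = solve-∀
  last-mark : h m ≡ suc m ^ 3
  last-mark = cube m
  upper-bound : ∀ x → x ∈ R (suc m) → x ℤ.≤ + (suc m ^ 3)
  upper-bound x x∈ with ∈R⁻ x∈
  ... | j , s≤s j≤m , refl = ℤ.+≤+ (subst (h j ≤ℕ_) last-mark (h-mono j≤m))

lemma4 : ∀ (n : ℕ) → 1 ≤ℕ n →
    (IsLeast (+ 1) (R n) × IsGreatest (+ (n ^ 3)) (R n))
    × card (R n) ≡ n
    × (∀ (x y : ℤ) → x ∈ R n → y ∈ R n → x ≢ y → n ^ 2 + 3 ≤ℕ ∣ x - y ∣)
    × GolombRuler (R n)
lemma4 n@(suc m) 0<n = (R-least 0<n , R-greatest m) , R-card , R-separated , R-golomb
  where open Marks n
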